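{- Let $\{a_n\}_{n\in\mathbb{Z}}$, $\{b_n\}_{n\in\mathbb{Z}}$, $\{s_n\}_{n\in\mathbb{Z}}$, $\{m_n\}_{n\in\mathbb{Z}}$ be sequences of complex numbers such that $a_n\neq 0$ and $b_n\neq 0$ for all $n$, and the $s_n$ are pairwise distinct. Let $F=(F(n,k))_{n,k\in\mathbb{Z}}$ and $G=(G(n,k))_{n,k\in\mathbb{Z}}$ be the lower-triangular matrices ($F(n,k)=G(n,k)=0$ for $n<k$) whose entries for $n\ge k$ are $$F(n,k)=\frac{b_n}{b_k}\prod_{i=k+1}^{n}\frac{m_i\,(s_k-s_{i-1}+a_{i-1}b_{i-1}m_{i-1})}{s_k-s_i},\qquad G(n,k)=\frac{a_k}{a_n}\prod_{i=k}^{n-1}\frac{m_i\,(s_n-s_{i+1}+a_{i+1}b_{i+1}m_{i+1})}{s_n-s_i}.$$ Then $F$ and $G$ form a matrix inversion, i.e. $\sum_{k\le i\le n}F(n,i)G(i,k)=\delta_{n,k}$ for all integers $n,k$.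
   Context: Empty products (upper limit one less than the lower limit) equal $1$. $\delta_{n,k}$ is the Kronecker delta. Two lower-triangular matrices $F,G$ indexed by $\mathbb{Z}$ form a "matrix inversion" if $\sum_{k\le i\le n}F(n,i)G(i,k)=\delta_{n,k}$ for all $n,k\in\mathbb{Z}$. -}

module Defs where

open import Level using (Level; _⊔_; suc)
open import Algebra.Bundles using (CommutativeRing)
open import Data.Integer using (ℤ; _≤_; ∣_∣; +_) renaming (_+_ to _+ℤ_; _-_ to _-ℤ_)
open import Data.Integer.Properties using (_≟_; _≤?_)
open import Data.Nat using (ℕ; zero) renaming (suc to sucℕ)
open import Relation.Nullary using (¬_; yes; no)
open import Relation.Binary.PropositionalEquality using (_≡_)

-- The inverse is written as a total function x ⁻¹
-- (its value at 0 is irrelevant); it is only assumed to invert nonzero x.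
record Field (c ℓ : Level) : Set (Level.suc (c ⊔ ℓ)) where
  field
    commutativeRing : CommutativeRing c ℓ
  open CommutativeRing commutativeRing public
  field
    _⁻¹       : Carrier → Carrier
    ⁻¹-cong   : ∀ {x y} → x ≈ y → x ⁻¹ ≈ y ⁻¹
    ⁻¹-inverse : ∀ {x} → ¬ (x ≈ 0#) → x * (x ⁻¹) ≈ 1#
    0≉1       : ¬ (0# ≈ 1#)

  infixl 6 _−_
  _−_ : Carrier → Carrier → Carrier
  x − y = x + (- y)

  prodFrom : (ℤ → Carrier) → ℤ → ℕ → Carrier
  prodFrom f lo zero       = 1#
  prodFrom f lo (sucℕ len) = f lo * prodFrom f (lo +ℤ + 1) len

  sumFrom : (ℤ → Carrier) → ℤ → ℕ → Carrier
  sumFrom f lo zero       = 0#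
  sumFrom f lo (sucℕ len) = f lo + sumFrom f (lo +ℤ + 1) len

  prodRange : (ℤ → Carrier) → ℤ → ℤ → Carrier
  prodRange f lo hi with lo ≤? hi
  ... | yes _ = prodFrom f lo (sucℕ ∣ hi -ℤ lo ∣)
  ... | no  _ = 1#

  sumRange : (ℤ → Carrier) → ℤ → ℤ → Carrier
  sumRange f lo hi with lo ≤? hi
  ... | yes _ = sumFrom f lo (sucℕ ∣ hi -ℤ lo ∣)
  ... | no  _ = 0#

  δ : ℤ → ℤ → Carrier
  δ n k with n ≟ k
  ... | yes _ = 1#
  ... | no  _ = 0#

  MatrixInversion : (ℤ → ℤ → Carrier) → (ℤ → ℤ → Carrier) → Set ℓ
  MatrixInversion F G =
    ∀ n k → sumRange (λ i → F n i * G i k) k n ≈ δ n k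

  Fmat : (a b s m : ℤ → Carrier) → ℤ → ℤ → Carrier
  Fmat a b s m n k with k ≤? n
  ... | yes _ = (b n * (b k ⁻¹)) *
                prodRange (λ i → (m i * (s k − s (i -ℤ + 1)
                                          + a (i -ℤ + 1) * b (i -ℤ + 1) * m (i -ℤ + 1)))
                                 * ((s k − s i) ⁻¹))
                          (k +ℤ + 1) n
  ... | no  _ = 0#

  Gmat : (a b s m : ℤ → Carrier) → ℤ → ℤ → Carrier
  Gmat a b s m n k with k ≤? n
  ... | yes _ = (a k * (a n ⁻¹)) *
                prodRange (λ i → (m i * (s n − s (i +ℤ + 1)
                                          + a (i +ℤ + 1) * b (i +ℤ + 1) * m (i +ℤ + 1)))
                                 * ((s n − s i) ⁻¹))
                          k (n -ℤ + 1)
  ... | no  _ = 0#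

-- Fix k and put x j = s (k + j) and e j = x j − a (k + j) b (k + j) m (k + j).  For n = k + N with
-- N ≥ 1 the summand F(n, k + t) G(k + t, k) collapses to
--   a k · b n · (m k ⋯ m n) · ∏_{j=1}^{N-1} (x t − e j) / ∏_{j ≤ N, j ≠ t} (x t − x j):
-- the factors x t − e j of F (j = t … N − 1) and of G (j = 1 … t) overlap exactly at j = t, and
-- x t − e t = a b m at k + t cancels the denominators of a k / a (k + t) and b n / b (k + t) and
-- supplies the missing m (k + t).  The sum over t is therefore the divided difference of a
-- polynomial of degree N − 1 on the N + 1 distinct nodes x 0 … x N, which vanishes.
module Submission where

open import Defs
open import Algebra.Bundles using (CommutativeMonoid)
open import Data.Integer using (ℤ; +_; ∣_∣; +≤+)
  renaming (_+_ to _+ℤ_; _-_ to _-ℤ_; _≤_ to _≤ℤ_; _<_ to _<ℤ_)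
import Data.Integer.Properties as ℤ
open import Data.Integer.Tactic.RingSolver using (solve-∀)
open import Data.Nat as Nat using (ℕ; zero; suc; _∸_; _≤_; _<_; z≤n; s≤s; z<s; s<s; s≤s⁻¹)
open import Data.Nat.Properties
  using (+-comm; +-suc; suc-injective; m+[n∸m]≡n; +-∸-assoc; <⇒≢; m≤n⇒m≤1+n; ≤-refl)
open import Data.Empty using (⊥-elim)
open import Data.Product using (Σ; _,_)
open import Function using (_∘_)
open import Relation.Nullary using (¬_; yes; no)
open import Relation.Binary.Definitions using (tri<; tri≈; tri>)
open import Relation.Binary.PropositionalEquality as ≡ using (_≡_; _≢_)
import Relation.Binary.Reasoning.Setoid as SetoidReasoning

module BigOperator {c ℓ} (M : CommutativeMonoid c ℓ) where
  open CommutativeMonoid M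
  open Nat using (_+_)
  open import Algebra.Properties.CommutativeSemigroup commutativeSemigroup
    using (interchange; xy∙z≈y∙xz)
  open SetoidReasoning setoid

  big : (ℕ → Carrier) → ℕ → Carrier
  big f zero    = ε
  big f (suc n) = f 0 ∙ big (λ j → f (suc j)) n

  big-cong : ∀ {f g} n → (∀ j → j < n → f j ≈ g j) → big f n ≈ big g n
  big-cong zero    _   = refl
  big-cong (suc n) f≈g = ∙-cong (f≈g 0 z<s) (big-cong n (λ j j<n → f≈g (suc j) (s<s j<n)))

  big-distrib : ∀ f g n → big (λ j → f j ∙ g j) n ≈ big f n ∙ big g n
  big-distrib f g zero    = sym (identityˡ ε)
  big-distrib f g (suc n) = trans (∙-congˡ (big-distrib _ _ n)) (interchange _ _ _ _)

  big-distrib₃ : ∀ f g h n → big (λ j → f j ∙ g j ∙ h j) n ≈ big f n ∙ big g n ∙ big h n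
  big-distrib₃ f g h n = trans (big-distrib _ h n) (∙-congʳ (big-distrib f g n))

  big-snoc : ∀ f n → big f (suc n) ≈ big f n ∙ f n
  big-snoc f zero    = trans (identityʳ _) (sym (identityˡ _))
  big-snoc f (suc n) = trans (∙-congˡ (big-snoc _ n)) (sym (assoc _ _ _))

  big-split : ∀ f m n → big f (m + n) ≈ big f m ∙ big (λ j → f (m + j)) n
  big-split f zero    n = sym (identityˡ _)
  big-split f (suc m) n = trans (∙-congˡ (big-split _ m n)) (sym (assoc _ _ _))

  big-splitAt : ∀ f {t n} → t ≤ n →
    big f (suc n) ≈ big f t ∙ (f t ∙ big (λ j → f (suc (t + j))) (n ∸ t))
  big-splitAt f z≤n       = sym (identityˡ _)
  big-splitAt f (s≤s t≤n) = trans (∙-congˡ (big-splitAt _ t≤n)) (sym (assoc _ _ _))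

  big-overlap : ∀ f {t n} → t ≤ suc n →
    big (λ j → f (suc j)) t ∙ big (λ j → f (t + j)) (suc n ∸ t) ≈ f t ∙ big (λ j → f (suc j)) n
  big-overlap f {n = n} z≤n = identityˡ (big f (suc n))
  big-overlap f {suc t} {n} (s≤s t≤n) = begin
    big g (suc t) ∙ big (λ j → g (t + j)) (n ∸ t)   ≈⟨ ∙-congʳ (big-snoc g t) ⟩
    (big g t ∙ g t) ∙ big (λ j → g (t + j)) (n ∸ t) ≈⟨ xy∙z≈y∙xz _ _ _ ⟩
    g t ∙ (big g t ∙ big (λ j → g (t + j)) (n ∸ t)) ≈⟨ ∙-congˡ (big-split g t (n ∸ t)) ⟨
    g t ∙ big g (t + (n ∸ t))                       ≡⟨ ≡.cong (λ l → g t ∙ big g l) (m+[n∸m]≡n t≤n) ⟩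
    g t ∙ big g n                                   ∎
    where
    g : ℕ → Carrier
    g j = f (suc j)

[i+m]+n≡i+[m+n] : ∀ i m n → (i +ℤ + m) +ℤ + n ≡ i +ℤ + (m Nat.+ n)
[i+m]+n≡i+[m+n] i m n = ≡.trans (ℤ.+-assoc i (+ m) (+ n)) (≡.cong (i +ℤ_) (≡.sym (ℤ.pos-+ m n)))

[i+1]+n≡i+[1+n] : ∀ i n → (i +ℤ + 1) +ℤ + n ≡ i +ℤ + suc n
[i+1]+n≡i+[1+n] i = [i+m]+n≡i+[m+n] i 1

[i+n]+1≡i+[1+n] : ∀ i n → (i +ℤ + n) +ℤ + 1 ≡ i +ℤ + suc n
[i+n]+1≡i+[1+n] i n = ≡.trans ([i+m]+n≡i+[m+n] i n 1) (≡.cong (λ l → i +ℤ + l) (+-comm n 1))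

[i+m+1]+n≡i+[1+m+n] : ∀ i m n → ((i +ℤ + m) +ℤ + 1) +ℤ + n ≡ i +ℤ + suc (m Nat.+ n)
[i+m+1]+n≡i+[1+m+n] i m n = ≡.trans ([i+1]+n≡i+[1+n] (i +ℤ + m) n)
  (≡.trans ([i+m]+n≡i+[m+n] i m (suc n)) (≡.cong (λ l → i +ℤ + l) (+-suc m n)))

i+[1+j]-1≡i+j : ∀ i j → (i +ℤ + suc j) -ℤ + 1 ≡ i +ℤ + j
i+[1+j]-1≡i+j i j = ≡.trans (≡.cong (λ n → (i +ℤ n) -ℤ + 1) (ℤ.pos-+ 1 j)) (cancel i (+ j))
  where
  cancel : ∀ i j → (i +ℤ (+ 1 +ℤ j)) -ℤ + 1 ≡ i +ℤ j
  cancel = solve-∀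

i-1+1≡i : ∀ i → (i -ℤ + 1) +ℤ + 1 ≡ i
i-1+1≡i = solve-∀

[i+j]-i≡j : ∀ i j → (i +ℤ j) -ℤ i ≡ j
[i+j]-i≡j = solve-∀

i+m≡i+n⇒m≡n : ∀ i {m n} → i +ℤ + m ≡ i +ℤ + n → m ≡ n
i+m≡i+n⇒m≡n i {m} {n} eq =
  ℤ.+-injective (≡.trans (≡.sym ([i+j]-i≡j i (+ m))) (≡.trans (≡.cong (_-ℤ i) eq) ([i+j]-i≡j i (+ n))))

i+1≰i : ∀ i → ¬ (i +ℤ + 1 ≤ℤ i)
i+1≰i i i+1≤i = ℤ.i≮i (ℤ.suc[i]≤j⇒i<j (≡.subst (_≤ℤ i) (ℤ.+-comm i (+ 1)) i+1≤i))

i≰i-1 : ∀ i → ¬ (i ≤ℤ i -ℤ + 1)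
i≰i-1 i i≤i-1 = i+1≰i (i -ℤ + 1) (≡.subst (_≤ℤ i -ℤ + 1) (≡.sym (i-1+1≡i i)) i≤i-1)

<⇒≡+suc : ∀ {i j} → i <ℤ j → Σ ℕ λ n → j ≡ i +ℤ + suc n
<⇒≡+suc {i} {j} i<j = ∣ gap ∣ , (begin
  j                              ≡⟨ expand i j ⟨
  i +ℤ (+ 1 +ℤ gap)              ≡⟨ ≡.cong (λ n → i +ℤ (+ 1 +ℤ n)) (ℤ.0≤i⇒+∣i∣≡i 0≤gap) ⟨
  i +ℤ (+ 1 +ℤ + ∣ gap ∣)        ≡⟨ ≡.cong (i +ℤ_) (ℤ.pos-+ 1 ∣ gap ∣) ⟨
  i +ℤ + suc ∣ gap ∣             ∎)
  where
  open ≡.≡-Reasoning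
  gap : ℤ
  gap = j -ℤ (+ 1 +ℤ i)
  0≤gap : + 0 ≤ℤ gap
  0≤gap = ℤ.i≤j⇒0≤j-i (ℤ.i<j⇒suc[i]≤j i<j)
  expand : ∀ i j → i +ℤ (+ 1 +ℤ (j -ℤ (+ 1 +ℤ i))) ≡ j
  expand = solve-∀

module _ {c ℓ} (K : Field c ℓ) where
  open Field K
  open import Algebra.Properties.Ring ring using (x∙y⁻¹≈ε⇒x≈y; +-identityʳ-unique; -‿involutive; -‿+-comm)
  open BigOperator *-commutativeMonoid
    using () renaming (big to ∏; big-distrib₃ to ∏-distrib₃; big-snoc to ∏-snoc;
                       big-splitAt to ∏-splitAt; big-overlap to ∏-overlap)
  open BigOperator +-commutativeMonoid
    using () renaming (big to ∑; big-cong to ∑-cong; big-distrib to ∑-distrib; big-snoc to ∑-snoc)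
  open SetoidReasoning setoid
  open import Algebra.Solver.CommutativeMonoid *-commutativeMonoid using (solve; _⊜_) renaming (_⊕_ to infixl 7 _⊗_)

  *-distribˡ-∑ : ∀ x f n → x * ∑ f n ≈ ∑ (λ j → x * f j) n
  *-distribˡ-∑ x f zero    = zeroʳ x
  *-distribˡ-∑ x f (suc n) = trans (distribˡ x _ _) (+-congˡ (*-distribˡ-∑ x _ n))

  x−y+y−z≈x−z : ∀ x y z → (x − y) + (y − z) ≈ x − z
  x−y+y−z≈x−z x y z = begin
    (x − y) + (y − z)   ≈⟨ +-assoc _ _ _ ⟩
    x + (- y + (y − z)) ≈⟨ +-congˡ (+-assoc _ _ _) ⟨
    x + ((- y + y) − z) ≈⟨ +-congˡ (+-congʳ (-‿inverseˡ y)) ⟩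
    x + (0# − z)        ≈⟨ +-congˡ (+-identityˡ _) ⟩
    x − z               ∎

  x−y+z≈x−[y−z] : ∀ x y z → x − y + z ≈ x − (y − z)
  x−y+z≈x−[y−z] x y z = begin
    x − y + z          ≈⟨ +-assoc _ _ _ ⟩
    x + (- y + z)      ≈⟨ +-congˡ (+-congˡ (-‿involutive z)) ⟨
    x + (- y + - - z)  ≈⟨ +-congˡ (-‿+-comm y (- z)) ⟩
    x − (y − z)        ∎

  x−[x−y]≈y : ∀ x y → x − (x − y) ≈ y
  x−[x−y]≈y x y = begin
    x − (x − y)  ≈⟨ x−y+z≈x−[y−z] x x y ⟨
    x − x + y    ≈⟨ +-congʳ (-‿inverseʳ x) ⟩
    0# + y       ≈⟨ +-identityˡ y ⟩
    y            ∎

  x≉y⇒x−y≉0 : ∀ {x y} → ¬ (x ≈ y) → ¬ (x − y ≈ 0#)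
  x≉y⇒x−y≉0 x≉y x−y≈0 = x≉y (x∙y⁻¹≈ε⇒x≈y _ _ x−y≈0)

  x≉0∧x*y≈0⇒y≈0 : ∀ {x y} → ¬ (x ≈ 0#) → x * y ≈ 0# → y ≈ 0#
  x≉0∧x*y≈0⇒y≈0 {x} {y} x≉0 xy≈0 = begin
    y                ≈⟨ *-identityˡ y ⟨
    1# * y           ≈⟨ *-congʳ (⁻¹-inverse x≉0) ⟨
    x * x ⁻¹ * y     ≈⟨ solve 3 (λ a b c → (a ⊗ b) ⊗ c ⊜ (a ⊗ c) ⊗ b) refl x (x ⁻¹) y ⟩
    x * y * x ⁻¹     ≈⟨ *-congʳ xy≈0 ⟩
    0# * x ⁻¹        ≈⟨ zeroˡ _ ⟩
    0#               ∎

  x*x⁻¹*y≈y : ∀ {x} → ¬ (x ≈ 0#) → ∀ y → x * x ⁻¹ * y ≈ y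
  x*x⁻¹*y≈y x≉0 y = trans (*-congʳ (⁻¹-inverse x≉0)) (*-identityˡ y)

  x*y*[z*x⁻¹]≈y*z : ∀ {x} y z → ¬ (x ≈ 0#) → x * y * (z * x ⁻¹) ≈ y * z
  x*y*[z*x⁻¹]≈y*z {x} y z x≉0 = begin
    x * y * (z * x ⁻¹)
      ≈⟨ solve 4 (λ a b c d → (a ⊗ b) ⊗ (c ⊗ d) ⊜ (a ⊗ d) ⊗ (b ⊗ c)) refl x y z (x ⁻¹) ⟩
    x * x ⁻¹ * (y * z)
      ≈⟨ x*x⁻¹*y≈y x≉0 (y * z) ⟩
    y * z ∎

  -- Divided differences

  Distinct : (ℕ → Carrier) → Set ℓ
  Distinct x = ∀ i j → i ≢ j → ¬ (x i ≈ x j)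

  -- weight x N t = ∏_{j ≤ N, j ≠ t} (x t − x j)⁻¹, split at j = t; so divDiff x N h is the
  -- divided difference on the nodes x 0 … x N of a function taking the value h t at x t.
  weight : (ℕ → Carrier) → ℕ → ℕ → Carrier
  weight x N t = ∏ (λ j → (x t − x j) ⁻¹) t * ∏ (λ j → (x t − x (suc (t Nat.+ j))) ⁻¹) (N ∸ t)

  divDiff : (ℕ → Carrier) → ℕ → (ℕ → Carrier) → Carrier
  divDiff x N h = ∑ (λ t → h t * weight x N t) (suc N)

  weight-snoc : ∀ x {N t} → t ≤ N → weight x (suc N) t ≈ weight x N t * (x t − x (suc N)) ⁻¹
  weight-snoc x {N} {t} t≤N = begin
    L * ∏ r (suc N ∸ t)
      ≡⟨ ≡.cong (λ n → L * ∏ r n) (+-∸-assoc 1 t≤N) ⟩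
    L * ∏ r (suc (N ∸ t))
      ≈⟨ *-congˡ (∏-snoc r (N ∸ t)) ⟩
    L * (∏ r (N ∸ t) * r (N ∸ t))
      ≡⟨ ≡.cong (λ n → L * (∏ r (N ∸ t) * (x t − x (suc n)) ⁻¹)) (m+[n∸m]≡n t≤N) ⟩
    L * (∏ r (N ∸ t) * (x t − x (suc N)) ⁻¹)
      ≈⟨ *-assoc _ _ _ ⟨
    weight x N t * (x t − x (suc N)) ⁻¹ ∎
    where
    L = ∏ (λ j → (x t − x j) ⁻¹) t
    r : ℕ → Carrier
    r j = (x t − x (suc (t Nat.+ j))) ⁻¹

  weight-cons : ∀ x N t → weight x (suc N) (suc t) ≈ weight (x ∘ suc) N t * (x (suc t) − x 0) ⁻¹
  weight-cons x N t = trans (*-assoc _ _ _) (*-comm _ _)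

  divDiff-cong : ∀ x N {g h} → (∀ t → g t ≈ h t) → divDiff x N g ≈ divDiff x N h
  divDiff-cong x N {g} {h} g≈h =
    ∑-cong {λ t → g t * weight x N t} {λ t → h t * weight x N t} (suc N) (λ t _ → *-congʳ (g≈h t))

  divDiff-removeLast : ∀ {x} → Distinct x → ∀ N (h : ℕ → Carrier) →
    divDiff x (suc N) (λ t → (x t − x (suc N)) * h t) ≈ divDiff x N h
  divDiff-removeLast {x} x-inj N h = begin
    ∑ term (suc (suc N))          ≈⟨ ∑-snoc term (suc N) ⟩
    ∑ term (suc N) + term (suc N) ≈⟨ +-cong (∑-cong {term} {λ t → h t * weight x N t} (suc N) term≈)
                                            lastTerm≈0 ⟩
    divDiff x N h + 0#            ≈⟨ +-identityʳ _ ⟩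
    divDiff x N h                 ∎
    where
    term : ℕ → Carrier
    term t = (x t − x (suc N)) * h t * weight x (suc N) t
    lastTerm≈0 : term (suc N) ≈ 0#
    lastTerm≈0 = trans (*-congʳ (trans (*-congʳ (-‿inverseʳ _)) (zeroˡ _))) (zeroˡ _)
    term≈ : ∀ t → t < suc N → term t ≈ h t * weight x N t
    term≈ t (s≤s t≤N) = trans (*-congˡ (weight-snoc x t≤N))
      (x*y*[z*x⁻¹]≈y*z _ _ (x≉y⇒x−y≉0 (x-inj t (suc N) (<⇒≢ (s≤s t≤N)))))

  divDiff-removeFirst : ∀ {x} → Distinct x → ∀ N (h : ℕ → Carrier) →
    divDiff x (suc N) (λ t → (x t − x 0) * h t) ≈ divDiff (x ∘ suc) N (h ∘ suc)
  divDiff-removeFirst {x} x-inj N h = begin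
    term 0 + ∑ (λ t → term (suc t)) (suc N)
      ≈⟨ +-cong firstTerm≈0 (∑-cong {term ∘ suc} {λ t → h (suc t) * weight (x ∘ suc) N t} (suc N)
                                     (λ t _ → term≈ t)) ⟩
    0# + divDiff (x ∘ suc) N (h ∘ suc)
      ≈⟨ +-identityˡ _ ⟩
    divDiff (x ∘ suc) N (h ∘ suc) ∎
    where
    term : ℕ → Carrier
    term t = (x t − x 0) * h t * weight x (suc N) t
    firstTerm≈0 : term 0 ≈ 0#
    firstTerm≈0 = trans (*-congʳ (trans (*-congʳ (-‿inverseʳ _)) (zeroˡ _))) (zeroˡ _)
    term≈ : ∀ t → term (suc t) ≈ h (suc t) * weight (x ∘ suc) N t
    term≈ t = trans (*-congˡ (weight-cons x N t))
      (x*y*[z*x⁻¹]≈y*z _ _ (x≉y⇒x−y≉0 (x-inj (suc t) 0 λ ())))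

  divDiff-linearFactor : ∀ {x} → Distinct x → ∀ N z (h : ℕ → Carrier) →
    divDiff x (suc N) (λ t → (x t − z) * h t)
      ≈ divDiff x N h + (x (suc N) − z) * divDiff x (suc N) h
  divDiff-linearFactor {x} x-inj N z h = begin
    ∑ (λ t → (x t − z) * h t * w t) (suc (suc N))
      ≈⟨ ∑-cong {λ t → (x t − z) * h t * w t} {λ t → A t + B t} (suc (suc N)) (λ t _ → split t) ⟩
    ∑ (λ t → A t + B t) (suc (suc N))
      ≈⟨ ∑-distrib A B (suc (suc N)) ⟩
    ∑ A (suc (suc N)) + ∑ B (suc (suc N))
      ≈⟨ +-cong (divDiff-removeLast x-inj N h) (sym (*-distribˡ-∑ _ (λ t → h t * w t) (suc (suc N)))) ⟩
    divDiff x N h + (x (suc N) − z) * divDiff x (suc N) h ∎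
    where
    w A B : ℕ → Carrier
    w = weight x (suc N)
    A t = (x t − x (suc N)) * h t * w t
    B t = (x (suc N) − z) * (h t * w t)
    split : ∀ t → (x t − z) * h t * w t ≈ A t + B t
    split t = begin
      (x t − z) * h t * w t                                       ≈⟨ *-congʳ (*-congʳ (x−y+y−z≈x−z _ _ _)) ⟨
      ((x t − x (suc N)) + (x (suc N) − z)) * h t * w t           ≈⟨ *-congʳ (distribʳ _ _ _) ⟩
      ((x t − x (suc N)) * h t + (x (suc N) − z) * h t) * w t     ≈⟨ distribʳ _ _ _ ⟩
      (x t − x (suc N)) * h t * w t + (x (suc N) − z) * h t * w t ≈⟨ +-congˡ (*-assoc _ _ _) ⟩
      A t + B t                                                   ∎

  -- With z = x 0, divDiff-linearFactor and divDiff-removeFirst express (x (suc N) − x 0) times the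
  -- sum as the difference of the divided differences of 1 on x 1 … x (suc N) and on x 0 … x N,
  -- which agree (they are 1 for N = 0 and vanish by induction otherwise).
  divDiff-const : ∀ {x} → Distinct x → ∀ N → divDiff x (suc N) (λ _ → 1#) ≈ 0#
  divDiff-const {x} x-inj N =
    x≉0∧x*y≈0⇒y≈0 (x≉y⇒x−y≉0 (x-inj (suc N) 0 λ ())) (+-identityʳ-unique _ _ (begin
      divDiff x N one + (x (suc N) − x 0) * divDiff x (suc N) one
        ≈⟨ divDiff-linearFactor x-inj N (x 0) one ⟨
      divDiff x (suc N) (λ t → (x t − x 0) * 1#)
        ≈⟨ divDiff-removeFirst x-inj N one ⟩
      divDiff (x ∘ suc) N one
        ≈⟨ agree N ⟩
      divDiff x N one ∎))
    where
    one : ℕ → Carrier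
    one _ = 1#
    agree : ∀ N → divDiff (x ∘ suc) N one ≈ divDiff x N one
    agree zero    = refl
    agree (suc N) = trans (divDiff-const (λ i j i≢j → x-inj (suc i) (suc j) (i≢j ∘ suc-injective)) N)
                            (sym (divDiff-const x-inj N))

  divDiff-∏-vanishes : ∀ {x} → Distinct x → ∀ (y : ℕ → Carrier) {d N} → d ≤ N →
    divDiff x (suc N) (λ t → ∏ (λ j → x t − y j) d) ≈ 0#
  divDiff-∏-vanishes x-inj y {N = N} z≤n = divDiff-const x-inj N
  divDiff-∏-vanishes {x} x-inj y {suc d} {suc N} (s≤s d≤N) = begin
    divDiff x (suc (suc N)) (λ t → ∏ (p t) (suc d))
      ≈⟨ divDiff-cong x (suc (suc N)) (λ t → trans (∏-snoc (p t) d) (*-comm _ _)) ⟩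
    divDiff x (suc (suc N)) (λ t → (x t − y d) * ∏ (p t) d)
      ≈⟨ divDiff-linearFactor x-inj (suc N) (y d) (λ t → ∏ (p t) d) ⟩
    divDiff x (suc N) (λ t → ∏ (p t) d)
      + (x (suc (suc N)) − y d) * divDiff x (suc (suc N)) (λ t → ∏ (p t) d)
      ≈⟨ +-cong (divDiff-∏-vanishes x-inj y d≤N)
                (*-congˡ (divDiff-∏-vanishes x-inj y (m≤n⇒m≤1+n d≤N))) ⟩
    0# + (x (suc (suc N)) − y d) * 0# ≈⟨ trans (+-identityˡ _) (zeroʳ _) ⟩
    0# ∎
    where
    p : ℕ → ℕ → Carrier
    p t j = x t − y j

  prodFrom-∏ : ∀ f lo g → (∀ j → f (lo +ℤ + j) ≈ g j) → ∀ len → prodFrom f lo len ≈ ∏ g len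
  prodFrom-∏ f lo g f≈g zero      = refl
  prodFrom-∏ f lo g f≈g (suc len) =
    *-cong (trans (reflexive (≡.cong f (≡.sym (ℤ.+-identityʳ lo)))) (f≈g 0))
           (prodFrom-∏ f (lo +ℤ + 1) (g ∘ suc)
             (λ j → trans (reflexive (≡.cong f ([i+1]+n≡i+[1+n] lo j))) (f≈g (suc j))) len)

  sumFrom-∑ : ∀ f lo g len → (∀ j → j < len → f (lo +ℤ + j) ≈ g j) → sumFrom f lo len ≈ ∑ g len
  sumFrom-∑ f lo g zero      f≈g = refl
  sumFrom-∑ f lo g (suc len) f≈g =
    +-cong (trans (reflexive (≡.cong f (≡.sym (ℤ.+-identityʳ lo)))) (f≈g 0 z<s))
           (sumFrom-∑ f (lo +ℤ + 1) (g ∘ suc) len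
             (λ j j<len → trans (reflexive (≡.cong f ([i+1]+n≡i+[1+n] lo j))) (f≈g (suc j) (s<s j<len))))

  prodRange-empty : ∀ f {lo hi} → ¬ (lo ≤ℤ hi) → prodRange f lo hi ≡ 1#
  prodRange-empty f {lo} {hi} lo≰hi with lo ℤ.≤? hi
  ... | yes lo≤hi = ⊥-elim (lo≰hi lo≤hi)
  ... | no  _     = ≡.refl

  sumRange-empty : ∀ f {lo hi} → ¬ (lo ≤ℤ hi) → sumRange f lo hi ≡ 0#
  sumRange-empty f {lo} {hi} lo≰hi with lo ℤ.≤? hi
  ... | yes lo≤hi = ⊥-elim (lo≰hi lo≤hi)
  ... | no  _     = ≡.refl

  prodRange-∏ : ∀ f lo len g → (∀ j → f (lo +ℤ + j) ≈ g j) →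
    prodRange f lo ((lo +ℤ + len) -ℤ + 1) ≈ ∏ g len
  prodRange-∏ f lo zero g _ rewrite ℤ.+-identityʳ lo = reflexive (prodRange-empty f (i≰i-1 lo))
  prodRange-∏ f lo (suc l) g f≈g rewrite i+[1+j]-1≡i+j lo l with lo ℤ.≤? lo +ℤ + l
  ... | yes _ rewrite [i+j]-i≡j lo (+ l) = prodFrom-∏ f lo g f≈g (suc l)
  ... | no lo≰lo+l = ⊥-elim (lo≰lo+l (ℤ.i≤i+j lo (+ l)))

  sumRange-∑ : ∀ f lo l g → (∀ j → j < suc l → f (lo +ℤ + j) ≈ g j) →
    sumRange f lo (lo +ℤ + l) ≈ ∑ g (suc l)
  sumRange-∑ f lo l g f≈g with lo ℤ.≤? lo +ℤ + l
  ... | yes _ rewrite [i+j]-i≡j lo (+ l) = sumFrom-∑ f lo g (suc l) f≈g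
  ... | no lo≰lo+l = ⊥-elim (lo≰lo+l (ℤ.i≤i+j lo (+ l)))

  δ-refl : ∀ n → δ n n ≡ 1#
  δ-refl n with n ℤ.≟ n
  ... | yes _  = ≡.refl
  ... | no n≢n = ⊥-elim (n≢n ≡.refl)

  δ-≢ : ∀ {n k} → n ≢ k → δ n k ≡ 0#
  δ-≢ {n} {k} n≢k with n ℤ.≟ k
  ... | yes n≡k = ⊥-elim (n≢k n≡k)
  ... | no _    = ≡.refl

  -- The matrices F and G

  module Inversion (a b s m : ℤ → Carrier)
                   (a≉0 : ∀ n → ¬ (a n ≈ 0#)) (b≉0 : ∀ n → ¬ (b n ≈ 0#))
                   (s-inj : ∀ i j → i ≢ j → ¬ (s i ≈ s j)) where

    F G : ℤ → ℤ → Carrier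
    F = Fmat a b s m
    G = Gmat a b s m

    -- Verbatim the factors of the products in Fmat and Gmat, so that F-≤ and G-≤ hold by refl.
    Ffactor Gfactor : ℤ → ℤ → Carrier
    Ffactor k i = (m i * (s k − s (i -ℤ + 1) + a (i -ℤ + 1) * b (i -ℤ + 1) * m (i -ℤ + 1)))
                  * ((s k − s i) ⁻¹)
    Gfactor n i = (m i * (s n − s (i +ℤ + 1) + a (i +ℤ + 1) * b (i +ℤ + 1) * m (i +ℤ + 1)))
                  * ((s n − s i) ⁻¹)

    F-≤ : ∀ {n k} → k ≤ℤ n → F n k ≡ (b n * (b k ⁻¹)) * prodRange (Ffactor k) (k +ℤ + 1) n
    F-≤ {n} {k} k≤n with k ℤ.≤? n
    ... | yes _   = ≡.refl
    ... | no k≰n = ⊥-elim (k≰n k≤n)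

    G-≤ : ∀ {n k} → k ≤ℤ n → G n k ≡ (a k * (a n ⁻¹)) * prodRange (Gfactor n) k (n -ℤ + 1)
    G-≤ {n} {k} k≤n with k ℤ.≤? n
    ... | yes _   = ≡.refl
    ... | no k≰n = ⊥-elim (k≰n k≤n)

    F-diagonal : ∀ n → F n n ≈ 1#
    F-diagonal n = begin
      F n n                                                ≡⟨ F-≤ ℤ.≤-refl ⟩
      b n * (b n ⁻¹) * prodRange (Ffactor n) (n +ℤ + 1) n  ≡⟨ ≡.cong (_ *_) (prodRange-empty _ (i+1≰i n)) ⟩
      b n * (b n ⁻¹) * 1#                                  ≈⟨ *-identityʳ _ ⟩
      b n * (b n ⁻¹)                                       ≈⟨ ⁻¹-inverse (b≉0 n) ⟩
      1#                                                   ∎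

    G-diagonal : ∀ n → G n n ≈ 1#
    G-diagonal n = begin
      G n n                                                ≡⟨ G-≤ ℤ.≤-refl ⟩
      a n * (a n ⁻¹) * prodRange (Gfactor n) n (n -ℤ + 1)  ≡⟨ ≡.cong (_ *_) (prodRange-empty _ (i≰i-1 n)) ⟩
      a n * (a n ⁻¹) * 1#                                  ≈⟨ *-identityʳ _ ⟩
      a n * (a n ⁻¹)                                       ≈⟨ ⁻¹-inverse (a≉0 n) ⟩
      1#                                                   ∎

    diagonal : ∀ n → sumRange (λ i → F n i * G i n) n n ≈ 1#
    diagonal n = begin
      sumRange (λ i → F n i * G i n) n n             ≡⟨ ≡.cong (sumRange _ n) (ℤ.+-identityʳ n) ⟨
      sumRange (λ i → F n i * G i n) n (n +ℤ + 0)    ≈⟨ sumRange-∑ _ n 0 (λ _ → 1#) term≈1 ⟩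
      1# + 0#                                        ≈⟨ +-identityʳ 1# ⟩
      1#                                             ∎
      where
      term≈1 : ∀ j → j < 1 → F n (n +ℤ + j) * G (n +ℤ + j) n ≈ 1#
      term≈1 zero _ rewrite ℤ.+-identityʳ n =
        trans (*-cong (F-diagonal n) (G-diagonal n)) (*-identityʳ 1#)
      term≈1 (suc j) (s<s ())

    module Shifted (k : ℤ) where

      x α β μ e : ℕ → Carrier
      x j = s (k +ℤ + j)
      α j = a (k +ℤ + j)
      β j = b (k +ℤ + j)
      μ j = m (k +ℤ + j)
      e j = x j − α j * β j * μ j

      x-distinct : Distinct x
      x-distinct i j i≢j = s-inj _ _ (i≢j ∘ i+m≡i+n⇒m≡n k)

      F-shifted : ∀ {N t} → t ≤ N → F (k +ℤ + N) (k +ℤ + t) ≈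
        β N * (β t ⁻¹) * (∏ (λ j → μ (suc (t Nat.+ j))) (N ∸ t) * ∏ (λ j → x t − e (t Nat.+ j)) (N ∸ t)
                          * ∏ (λ j → (x t − x (suc (t Nat.+ j))) ⁻¹) (N ∸ t))
      F-shifted {N} {t} t≤N = begin
        F (k +ℤ + N) (k +ℤ + t)
          ≡⟨ F-≤ (ℤ.+-monoʳ-≤ k (+≤+ t≤N)) ⟩
        β N * (β t ⁻¹) * prodRange (Ffactor (k +ℤ + t)) lo (k +ℤ + N)
          ≡⟨ ≡.cong (λ hi → β N * (β t ⁻¹) * prodRange (Ffactor (k +ℤ + t)) lo hi) hi≡ ⟩
        β N * (β t ⁻¹) * prodRange (Ffactor (k +ℤ + t)) lo ((lo +ℤ + (N ∸ t)) -ℤ + 1)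
          ≈⟨ *-congˡ (prodRange-∏ _ lo (N ∸ t) _ factor≈) ⟩
        β N * (β t ⁻¹) * ∏ (λ j → μ (suc (t Nat.+ j)) * (x t − e (t Nat.+ j))
                                  * (x t − x (suc (t Nat.+ j))) ⁻¹) (N ∸ t)
          ≈⟨ *-congˡ (∏-distrib₃ _ _ _ (N ∸ t)) ⟩
        _ ∎
        where
        lo : ℤ
        lo = (k +ℤ + t) +ℤ + 1
        hi≡ : k +ℤ + N ≡ (lo +ℤ + (N ∸ t)) -ℤ + 1
        hi≡ = ≡.sym (≡.trans (≡.cong (_-ℤ + 1) (≡.trans ([i+m+1]+n≡i+[1+m+n] k t (N ∸ t))
                                                        (≡.cong (λ n → k +ℤ + suc n) (m+[n∸m]≡n t≤N))))
                             (i+[1+j]-1≡i+j k N))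
        factor≈ : ∀ j → Ffactor (k +ℤ + t) (lo +ℤ + j)
                        ≈ μ (suc (t Nat.+ j)) * (x t − e (t Nat.+ j)) * (x t − x (suc (t Nat.+ j))) ⁻¹
        factor≈ j rewrite [i+m+1]+n≡i+[1+m+n] k t j | i+[1+j]-1≡i+j k (t Nat.+ j) =
          *-congʳ (*-congˡ (x−y+z≈x−[y−z] _ _ _))

      G-shifted : ∀ t → G (k +ℤ + t) k ≈
        a k * (α t ⁻¹) * (∏ μ t * ∏ (λ j → x t − e (suc j)) t * ∏ (λ j → (x t − x j) ⁻¹) t)
      G-shifted t = begin
        G (k +ℤ + t) k
          ≡⟨ G-≤ (ℤ.i≤i+j k (+ t)) ⟩
        a k * (α t ⁻¹) * prodRange (Gfactor (k +ℤ + t)) k ((k +ℤ + t) -ℤ + 1)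
          ≈⟨ *-congˡ (prodRange-∏ _ k t _ factor≈) ⟩
        a k * (α t ⁻¹) * ∏ (λ j → μ j * (x t − e (suc j)) * (x t − x j) ⁻¹) t
          ≈⟨ *-congˡ (∏-distrib₃ _ _ _ t) ⟩
        _ ∎
        where
        factor≈ : ∀ j → Gfactor (k +ℤ + t) (k +ℤ + j) ≈ μ j * (x t − e (suc j)) * (x t − x j) ⁻¹
        factor≈ j rewrite [i+n]+1≡i+[1+n] k j = *-congʳ (*-congˡ (x−y+z≈x−[y−z] _ _ _))

      coefficient : ℕ → Carrier
      coefficient N = a k * β (suc N) * ∏ μ (suc (suc N))

      summand : ∀ {N t} → t ≤ suc N → F (k +ℤ + suc N) (k +ℤ + t) * G (k +ℤ + t) k ≈
        coefficient N * (∏ (λ j → x t − e (suc j)) N * weight x (suc N) t)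
      summand {N} {t} t≤1+N = begin
        F (k +ℤ + suc N) (k +ℤ + t) * G (k +ℤ + t) k
          ≈⟨ *-cong (F-shifted t≤1+N) (G-shifted t) ⟩
        β M * (β t ⁻¹) * (μR * eR * wR) * (a k * (α t ⁻¹) * (μL * eL * wL))
          ≈⟨ solve 10 (λ βM βt⁻¹ μR eR wR ak αt⁻¹ μL eL wL →
               (βM ⊗ βt⁻¹ ⊗ (μR ⊗ eR ⊗ wR)) ⊗ (ak ⊗ αt⁻¹ ⊗ (μL ⊗ eL ⊗ wL))
               ⊜ (αt⁻¹ ⊗ βt⁻¹) ⊗ ((ak ⊗ βM ⊗ (μL ⊗ μR)) ⊗ ((eL ⊗ eR) ⊗ (wL ⊗ wR))))
               refl (β M) (β t ⁻¹) μR eR wR (a k) (α t ⁻¹) μL eL wL ⟩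
        (α t ⁻¹ * β t ⁻¹) * ((a k * β M * (μL * μR)) * ((eL * eR) * weight x M t))
          ≈⟨ *-congˡ (*-congˡ (*-congʳ (trans (∏-overlap (λ j → x t − e j) t≤1+N)
                                              (*-congʳ (x−[x−y]≈y (x t) _))))) ⟩
        (α t ⁻¹ * β t ⁻¹) * ((a k * β M * (μL * μR)) * ((α t * β t * μ t * Q) * weight x M t))
          ≈⟨ solve 11 (λ αt⁻¹ βt⁻¹ ak βM μL μR αt βt μt q w →
               (αt⁻¹ ⊗ βt⁻¹) ⊗ ((ak ⊗ βM ⊗ (μL ⊗ μR)) ⊗ ((αt ⊗ βt ⊗ μt ⊗ q) ⊗ w))
               ⊜ αt ⊗ αt⁻¹ ⊗ (βt ⊗ βt⁻¹ ⊗ (ak ⊗ βM ⊗ (μL ⊗ (μt ⊗ μR)) ⊗ (q ⊗ w))))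
               refl (α t ⁻¹) (β t ⁻¹) (a k) (β M) μL μR (α t) (β t) (μ t) Q (weight x M t) ⟩
        α t * α t ⁻¹ * (β t * β t ⁻¹ * (a k * β M * (μL * (μ t * μR)) * (Q * weight x M t)))
          ≈⟨ trans (x*x⁻¹*y≈y (a≉0 _) _) (x*x⁻¹*y≈y (b≉0 _) _) ⟩
        a k * β M * (μL * (μ t * μR)) * (Q * weight x M t)
          ≈⟨ *-congʳ (*-congˡ (∏-splitAt μ t≤1+N)) ⟨
        coefficient N * (Q * weight x (suc N) t) ∎
        where
        M = suc N
        μR = ∏ (λ j → μ (suc (t Nat.+ j))) (M ∸ t)
        eR = ∏ (λ j → x t − e (t Nat.+ j)) (M ∸ t)
        wR = ∏ (λ j → (x t − x (suc (t Nat.+ j))) ⁻¹) (M ∸ t)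
        μL = ∏ μ t
        eL = ∏ (λ j → x t − e (suc j)) t
        wL = ∏ (λ j → (x t − x j) ⁻¹) t
        Q = ∏ (λ j → x t − e (suc j)) N

      offDiagonal : ∀ N → sumRange (λ i → F (k +ℤ + suc N) i * G i k) k (k +ℤ + suc N) ≈ 0#
      offDiagonal N = begin
        sumRange (λ i → F (k +ℤ + suc N) i * G i k) k (k +ℤ + suc N)
          ≈⟨ sumRange-∑ _ k (suc N) _ (λ t t<2+N → summand (s≤s⁻¹ t<2+N)) ⟩
        ∑ (λ t → coefficient N * (Q t * weight x (suc N) t)) (suc (suc N))
          ≈⟨ *-distribˡ-∑ (coefficient N) (λ t → Q t * weight x (suc N) t) (suc (suc N)) ⟨
        coefficient N * divDiff x (suc N) Q
          ≈⟨ *-congˡ (divDiff-∏-vanishes x-distinct (e ∘ suc) (≤-refl {N})) ⟩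
        coefficient N * 0#
          ≈⟨ zeroʳ _ ⟩
        0# ∎
        where
        Q : ℕ → Carrier
        Q t = ∏ (λ j → x t − e (suc j)) N

    inversion : MatrixInversion F G
    inversion n k with ℤ.<-cmp k n
    ... | tri< k<n k≢n _ with <⇒≡+suc k<n
    ...   | N , ≡.refl = trans (Shifted.offDiagonal k N) (reflexive (≡.sym (δ-≢ (k≢n ∘ ≡.sym))))
    inversion n k | tri≈ _ ≡.refl _ = trans (diagonal n) (reflexive (≡.sym (δ-refl n)))
    inversion n k | tri> _ k≢n n<k =
      trans (reflexive (sumRange-empty _ (ℤ.<⇒≱ n<k))) (reflexive (≡.sym (δ-≢ (k≢n ∘ ≡.sym))))

theorem1p3 : ∀ {c ℓ} (K : Field c ℓ) → let open Field K in
    (a b s m : ℤ → Carrier) →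
    (∀ n → ¬ (a n ≈ 0#)) →
    (∀ n → ¬ (b n ≈ 0#)) →
    (∀ i j → i ≢ j → ¬ (s i ≈ s j)) →
    MatrixInversion (Fmat a b s m) (Gmat a b s m)
theorem1p3 K a b s m a≉0 b≉0 s-inj = Inversion.inversion K a b s m a≉0 b≉0 s-inj
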